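{- Let $p, q \in \mathbf{PS}$ and $k, n \in \omega$ be such that $q \leq p$, $I_k(p) \in \mathcal{I}(q)$, and $|q^{ -1}(1) \cap \min I_k(p)| = |p^{ -1}(1) \cap \min I_k(p)| + n$. Then $I_k(p) = I_{k+n}(q)$.
   Context: Silver forcing $\mathbf{PS}$ consists of all partial functions $p$ from $\omega$ to $2$ such that $\omega \setminus \operatorname{dom} p$ is infinite and $p^{ -1}(1)$ is infinite; it is ordered by $p \leq q$ iff $q \subseteq p$. For a partial or total function $p$ from $\omega$ to $2$ and $n \in \omega$, let $I_n(p) = \{k \in \omega : |k \cap p^{ -1}(1)| = n\}$ (where a natural number $k$ is identified with $\{0,\dots,k-1\}$), and $\mathcal{I}(p) = \{I_n(p) : n \in \omega\}$. -}

module Defs where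

open import Data.Nat using (ℕ; zero; suc; _+_; _≤_; _<_)
open import Data.Bool using (Bool; true; false)
open import Data.Maybe using (Maybe; just; nothing)
open import Data.Product using (Σ; ∃; _×_; _,_)
open import Relation.Binary.PropositionalEquality using (_≡_; _≢_)
open import Function.Bundles using (_⇔_)
open import Relation.Nullary using (¬_)

PartialFun : Set
PartialFun = ℕ → Maybe Bool

Infinite : (ℕ → Set) → Set
Infinite P = ∀ m → ∃ λ j → m ≤ j × P j

InPS : PartialFun → Set
InPS p = Infinite (λ j → p j ≡ nothing) × Infinite (λ j → p j ≡ just true)

_≤PS_ : PartialFun → PartialFun → Set
p ≤PS q = ∀ i b → q i ≡ just b → p i ≡ just b

-- ones p k = |k ∩ p⁻¹(1)| = #{ i < k : p i = 1 }.
ones : PartialFun → ℕ → ℕ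
ones p zero = zero
ones p (suc k) with p k
... | just true = suc (ones p k)
... | just false = ones p k
... | nothing = ones p k

I : ℕ → PartialFun → ℕ → Set
I n p k = ones p k ≡ n

_≐_ : (ℕ → Set) → (ℕ → Set) → Set
A ≐ B = ∀ j → A j ⇔ B j

_∈𝓘_ : (ℕ → Set) → PartialFun → Set
A ∈𝓘 p = ∃ λ n → A ≐ I n p

IsMin : (ℕ → Set) → ℕ → Set
IsMin A m = A m × (∀ j → j < m → ¬ A j)

module Submission where

open import Defs
open import Data.Nat using (ℕ; _+_)
open import Data.Product using (_,_)
open import Function.Bundles using (Equivalence)
open import Relation.Binary.PropositionalEquality using (_≡_; cong; subst; module ≡-Reasoning)

∈𝓘-index : ∀ {A q j} → A ≐ I j q → ∀ m → A m → ones q m ≡ j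
∈𝓘-index A≐Ijq m m∈A = Equivalence.to (A≐Ijq m) m∈A

-- Only that m lies in I_k(p) is needed: one point of I_k(p) = I_j(q) already pins down j.
lemma2 : (p q : PartialFun) → InPS p → InPS q → (k n : ℕ) →
    q ≤PS p → I k p ∈𝓘 q →
    (m : ℕ) → IsMin (I k p) m →
    ones q m ≡ ones p m + n →
    I k p ≐ I (k + n) q
lemma2 p q _ _ k n _ (j , Ikp≐Ijq) m (m∈Ikp , _) onesq≡onesp+n =
  subst (λ t → I k p ≐ I t q) j≡k+n Ikp≐Ijq
  where
  open ≡-Reasoning
  j≡k+n : j ≡ k + n
  j≡k+n = begin
    j             ≡⟨ ∈𝓘-index Ikp≐Ijq m m∈Ikp ⟨
    ones q m      ≡⟨ onesq≡onesp+n ⟩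
    ones p m + n  ≡⟨ cong (_+ n) m∈Ikp ⟩
    k + n         ∎
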